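{- Let $T$ be an order tree and $G$ a $T$-graph. The following are equivalent: (i) for every limit ordinal $\sigma$, every component of $G-T^{\le\sigma}$ has finite neighbourhood; (ii) for every ordinal $\sigma$, every component of $G-T^{\le\sigma}$ has finite neighbourhood; (iii) for every successor $t\in T$, the vertex set $\lfloor t\rfloor$ has finite neighbourhood in $G$.
   Context: An order tree is a poset $(T,\le)$ with a unique minimal element in which every $\lceil t\rceil=\{t'\le t\}$ is well-ordered; $\mathring{\lceil t\rceil}=\lceil t\rceil\setminus\{t\}$ and $\lfloor t\rfloor=\{t'\in T: t\le t'\}$. $t'$ is a successor of $t$ if $t<t'$ with no point strictly between; a point is a limit if it is not a successor of any point. The height of $t$ is the order type of $\mathring{\lceil t\rceil}$; $T^i$ is the set of points of height $i$ and $T^{\le\sigma}=\bigcup_{j\le\sigma}T^j$. A graph $G$ is a $T$-graph if $V(G)=T$, endvertices of every edge are comparable in $T$, and for each $t$ the set of neighbours of $t$ below $t$ is cofinal in $\mathring{\lceil t\rceil}$. (Condition (i) is what the paper calls "$G$ has finite adhesion".) -}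

module Defs where

open import Level using (0ℓ)
open import Data.Product using (Σ; ∃; ∃-syntax; _×_; _,_)
open import Data.Sum using (_⊎_)
open import Data.Empty using (⊥)
open import Data.List using (List)
open import Data.List.Membership.Propositional using (_∈_)
open import Relation.Nullary using (¬_)
open import Relation.Binary.PropositionalEquality using (_≡_; _≢_)
open import Relation.Binary.Construct.Closure.ReflexiveTransitive using (Star)

Subset : Set → Set₁
Subset A = A → Set

Finite : {A : Set} → Subset A → Set
Finite {A} P = Σ (List A) λ xs → (∀ x → P x → x ∈ xs)

record OrderTree : Set₁ where
  field
    Carrier : Set
    _≤_     : Carrier → Carrier → Set
    ≤-refl    : ∀ x → x ≤ x
    ≤-trans   : ∀ {x y z} → x ≤ y → y ≤ z → x ≤ z
    ≤-antisym : ∀ {x y} → x ≤ y → y ≤ x → x ≡ y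

  _<_ : Carrier → Carrier → Set
  x < y = (x ≤ y) × (x ≢ y)

  Minimal : Carrier → Set
  Minimal x = ∀ y → y ≤ x → y ≡ x

  ⌈_⌉ : Carrier → Subset Carrier
  ⌈ t ⌉ t' = t' ≤ t

  ⌊_⌋ : Carrier → Subset Carrier
  ⌊ t ⌋ t' = t ≤ t'

  WellOrdered : Subset Carrier → Set₁
  WellOrdered S =
    (∀ x y → S x → S y → (x ≤ y) ⊎ (y ≤ x)) ×
    (∀ (A : Subset Carrier) → (∀ x → A x → S x) → Σ Carrier A →
       Σ Carrier λ m → (A m × (∀ y → A y → m ≤ y)))

  field
    root        : Carrier
    root-min    : Minimal root
    root-unique : ∀ x → Minimal x → x ≡ root
    down-wo     : ∀ t → WellOrdered ⌈ t ⌉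

  IsSuccessorOf : Carrier → Carrier → Set
  IsSuccessorOf t' t = (t < t') × ¬ (∃[ u ] ((t < u) × (u < t')))

  IsSuccessor : Carrier → Set
  IsSuccessor t' = ∃[ t ] IsSuccessorOf t' t

  IsLimit : Carrier → Set
  IsLimit t = ¬ IsSuccessor t

  -- height(s) ≤ height(t): the well-order ⌈s⌉° is isomorphic to an initial
  -- segment of the well-order ⌈t⌉° (comparison of order types).
  HeightLe : Carrier → Carrier → Set
  HeightLe s t = Σ (Carrier → Carrier) λ f →
      ((∀ x → x < s → f x < t) ×
       (∀ x y → x < s → y < s → x < y → f x < f y) ×
       (∀ z x → z < t → x < s → z < f x → ∃[ y ] ((y < s) × (f y ≡ z))))

  -- T^{≤ σ} where σ = height(s): points of height at most height(s).
  LevelUpTo : Carrier → Subset Carrier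
  LevelUpTo s v = HeightLe v s

record TGraph (T : OrderTree) : Set₁ where
  open OrderTree T
  field
    E       : Carrier → Carrier → Set
    E-sym   : ∀ {x y} → E x y → E y x
    E-irr   : ∀ {x} → ¬ E x x
    E-comparable : ∀ {x y} → E x y → (x ≤ y) ⊎ (y ≤ x)
    E-cofinal : ∀ t s → s < t → ∃[ u ] ((s ≤ u) × (u < t) × E u t)

  E-minus : Subset Carrier → Carrier → Carrier → Set
  E-minus X x y = ¬ X x × ¬ X y × E x y

  IsComponentMinus : Subset Carrier → Subset Carrier → Set
  IsComponentMinus X C =
    (∀ x → C x → ¬ X x) ×
    (∃[ x ] C x) ×
    (∀ x y → C x → C y → Star (E-minus X) x y) ×
    (∀ x y → C x → ¬ X y → E x y → C y)

  N : Subset Carrier → Subset Carrier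
  N C v = ¬ C v × ∃[ u ] (C u × E u v)

{-# OPTIONS --safe #-}
-- A component C of G - T^{≤σ} is the up-closure ⌊w⌋ of the least point w
-- outside T^{≤σ} below any vertex of C: all points below w lie in T^{≤σ}, none
-- above w does, and ⌊w⌋ is connected because down-neighbours are cofinal.  If w
-- were a limit, the height embeddings of the points below w would glue to one for
-- w, putting w itself into T^{≤σ}; so w is a successor and (iii) gives (ii).
-- Conversely, for t a successor of p, ⌊t⌋ is a component of G - T^{≤ height p},
-- which gives (ii) ⇒ (iii); and (i) ⇒ (iii) follows by induction on t, since for
-- p itself a successor N(⌊t⌋) ⊆ {p} ∪ N(⌊p⌋).
module Submission where

open import Defs
open import Level using (0ℓ)
open import Axiom.ExcludedMiddle using (ExcludedMiddle)
open import Axiom.DoubleNegationElimination using (DoubleNegationElimination; em⇒dne)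
open import Function.Bundles using (_⇔_; mk⇔)
open import Data.Product using (_×_; Σ; ∃-syntax; _,_; proj₁; proj₂)
open import Data.Sum using (_⊎_; inj₁; inj₂; [_,_]′)
open import Data.Empty using (⊥-elim)
open import Data.List using (_∷_)
open import Data.List.Membership.Propositional using (_∈_)
open import Data.List.Relation.Unary.Any using (here; there)
open import Relation.Nullary using (¬_; yes; no)
open import Relation.Binary.PropositionalEquality using (_≡_; _≢_; refl; sym; trans; subst)
open import Relation.Binary.Construct.Closure.ReflexiveTransitive using (Star; ε; _◅_; _◅◅_; reverse)

Finite-⊆ : {A : Set} {P Q : Subset A} → (∀ x → P x → Q x) → Finite Q → Finite P
Finite-⊆ P⊆Q (xs , Q⊆xs) = xs , λ x Px → Q⊆xs x (P⊆Q x Px)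

module OrderTreeProperties (T : OrderTree) where
  open OrderTree T

  <-≤-trans : ∀ {x y z} → x < y → y ≤ z → x < z
  <-≤-trans (x≤y , x≢y) y≤z =
    ≤-trans x≤y y≤z , λ { refl → x≢y (≤-antisym x≤y y≤z) }

  <-trans : ∀ {x y z} → x < y → y < z → x < z
  <-trans x<y (y≤z , _) = <-≤-trans x<y y≤z

  <⇒≱ : ∀ {x y} → x < y → ¬ (y ≤ x)
  <⇒≱ (x≤y , x≢y) y≤x = x≢y (≤-antisym x≤y y≤x)

  <-irrefl : ∀ {x} → ¬ (x < x)
  <-irrefl (_ , x≢x) = x≢x refl

  comparable : ∀ {x y t} → x ≤ t → y ≤ t → (x ≤ y) ⊎ (y ≤ x)
  comparable {x} {y} {t} = proj₁ (down-wo t) x y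

  ≢⇒<⊎> : ∀ {x y t} → x ≤ t → y ≤ t → x ≢ y → (x < y) ⊎ (y < x)
  ≢⇒<⊎> x≤t y≤t x≢y with comparable x≤t y≤t
  ... | inj₁ x≤y = inj₁ (x≤y , x≢y)
  ... | inj₂ y≤x = inj₂ (y≤x , λ y≡x → x≢y (sym y≡x))

  least : ∀ (A : Subset Carrier) t → (∀ x → A x → x ≤ t) → Σ Carrier A →
          Σ Carrier λ m → A m × (∀ y → A y → m ≤ y)
  least A t = proj₂ (down-wo t) A

  IsHeightEmbedding : Carrier → Carrier → (Carrier → Carrier) → Set
  IsHeightEmbedding v s f =
    (∀ x → x < v → f x < s) ×
    (∀ x y → x < v → y < v → x < y → f x < f y) ×
    (∀ z x → z < s → x < v → z < f x → ∃[ y ] ((y < v) × (f y ≡ z)))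

  ≤⇒HeightLe : ∀ {y p} → y ≤ p → HeightLe y p
  ≤⇒HeightLe y≤p =
    (λ x → x) , (λ x x<y → <-≤-trans x<y y≤p) , (λ _ _ _ _ x<y → x<y) ,
    (λ z x _ x<y z<x → z , <-trans z<x x<y , refl)

module TGraphProperties {T : OrderTree} (G : TGraph T) where
  open OrderTree T
  open OrderTreeProperties T
  open TGraph G

  edge-leaving-⌊⌋ : ∀ {t x y} → t ≤ x → E x y → ¬ (t ≤ y) → y < t
  edge-leaving-⌊⌋ t≤x e t≰y with E-comparable e
  ... | inj₁ x≤y = ⊥-elim (t≰y (≤-trans t≤x x≤y))
  ... | inj₂ y≤x with comparable y≤x t≤x
  ... | inj₁ y≤t = y≤t , λ { refl → t≰y y≤t }
  ... | inj₂ t≤y = ⊥-elim (t≰y t≤y)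

  closed-along : ∀ {X D : Subset Carrier} {a v} → (∀ x y → D x → ¬ X y → E x y → D y) →
                 D a → Star (E-minus X) a v → D v
  closed-along closed Da ε = Da
  closed-along closed Da ((_ , ¬Xb , e) ◅ path) =
    closed-along closed (closed _ _ Da ¬Xb e) path

  component-⊆ : ∀ {X C D : Subset Carrier} {a} → IsComponentMinus X C → IsComponentMinus X D →
                C a → D a → ∀ v → C v → D v
  component-⊆ (_ , _ , C-connected , _) (_ , _ , _ , D-closed) Ca Da v Cv =
    closed-along D-closed Da (C-connected _ v Ca Cv)

  N-⊆ : ∀ {C D : Subset Carrier} → (∀ v → C v → D v) → (∀ v → D v → C v) → ∀ v → N C v → N D v
  N-⊆ C⊆D D⊆C v (¬Cv , u , Cu , e) = (λ Dv → ¬Cv (D⊆C v Dv)) , u , C⊆D u Cu , e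

module ClassicalOrderTreeProperties (em : ExcludedMiddle 0ℓ) (T : OrderTree) where
  open OrderTree T
  open OrderTreeProperties T

  private
    dne : DoubleNegationElimination 0ℓ
    dne = em⇒dne em

  <-induction : (P : Subset Carrier) → (∀ x → (∀ y → y < x → P y) → P x) → ∀ x → P x
  <-induction P step x = dne λ ¬Px →
    let m , (m≤x , ¬Pm) , m-least =
          least (λ y → y ≤ x × ¬ P y) x (λ _ → proj₁) (x , ≤-refl x , ¬Px)
    in ¬Pm (step m λ y y<m → dne λ ¬Py →
         <⇒≱ y<m (m-least y (≤-trans (proj₁ y<m) m≤x , ¬Py)))

  ≤⇒≡⊎< : ∀ {x y} → x ≤ y → (x ≡ y) ⊎ (x < y)
  ≤⇒≡⊎< {x} {y} x≤y with em {x ≡ y}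
  ... | yes x≡y = inj₁ x≡y
  ... | no x≢y = inj₂ (x≤y , x≢y)

  ≤⊎> : ∀ {x y t} → x ≤ t → y ≤ t → (x ≤ y) ⊎ (y < x)
  ≤⊎> {x} x≤t y≤t with comparable x≤t y≤t
  ... | inj₁ x≤y = inj₁ x≤y
  ... | inj₂ y≤x with ≤⇒≡⊎< y≤x
  ... | inj₁ refl = inj₁ (≤-refl x)
  ... | inj₂ y<x = inj₂ y<x

  <-successor⇒≤ : ∀ {t p v} → IsSuccessorOf t p → v < t → v ≤ p
  <-successor⇒≤ ((p≤t , _) , nothing-between) v<t with ≤⊎> (proj₁ v<t) p≤t
  ... | inj₁ v≤p = v≤p
  ... | inj₂ p<v = ⊥-elim (nothing-between (_ , p<v , v<t))

  limit⇒between : ∀ {w x} → IsLimit w → x < w → ∃[ y ] ((x < y) × (y < w))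
  limit⇒between lim x<w = dne λ none → lim (_ , x<w , none)

  embedding-inflationary : ∀ {x} (f : Carrier → Carrier) → (∀ y → y < x → f y < x) →
    (∀ y z → y < x → z < x → y < z → f y < f z) → ∀ y → y < x → y ≤ f y
  embedding-inflationary {x} f into mono =
    <-induction (λ y → y < x → y ≤ f y) λ y ih y<x →
      [ (λ fy≤y → dne λ y≰fy →
          let fy<y = fy≤y , λ fy≡y → y≰fy (subst (y ≤_) (sym fy≡y) (≤-refl y))
          in <⇒≱ (mono (f y) y (into y y<x) y<x fy<y) (ih (f y) fy<y (into y y<x)))
      , (λ y≤fy → y≤fy) ]′ (comparable (proj₁ (into y y<x)) (proj₁ y<x))

  <⇒¬HeightLe : ∀ {p x} → p < x → ¬ HeightLe x p
  <⇒¬HeightLe p<x (f , into , mono , _) =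
    <⇒≱ (into _ p<x) (embedding-inflationary f (λ y y<x → <-trans (into y y<x) p<x) mono _ p<x)

  ≤-HeightLe-trans : ∀ {y v s} → y ≤ v → HeightLe v s → HeightLe y s
  ≤-HeightLe-trans {y} {v} {s} y≤v (f , into , mono , initial) =
    f , (λ x x<y → into x (<y⇒<v x<y)) ,
    (λ x x' x<y x'<y → mono x x' (<y⇒<v x<y) (<y⇒<v x'<y)) , initial′
    where
    <y⇒<v : ∀ {x} → x < y → x < v
    <y⇒<v x<y = <-≤-trans x<y y≤v
    initial′ : ∀ z x → z < s → x < y → z < f x → ∃[ x' ] ((x' < y) × (f x' ≡ z))
    initial′ z x z<s x<y z<fx with initial z x z<s (<y⇒<v x<y) z<fx
    ... | x' , x'<v , refl with ≤⊎> (proj₁ (<y⇒<v x<y)) (proj₁ x'<v)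
    ... | inj₁ x≤x' = ⊥-elim (<⇒≱ z<fx (monotone x≤x'))
      where
      monotone : x ≤ x' → f x ≤ f x'
      monotone x≤x' with ≤⇒≡⊎< x≤x'
      ... | inj₁ refl = ≤-refl (f x)
      ... | inj₂ x<x' = proj₁ (mono x x' (<y⇒<v x<y) x'<v x<x')
    ... | inj₂ x'<x = x' , <-trans x'<x x<y , refl

  private
    agreeing-below⇒≮ : ∀ {a b s f g x} → IsHeightEmbedding a s f → IsHeightEmbedding b s g →
      x < a → x < b → (∀ y → y < x → f y ≡ g y) → ¬ (f x < g x)
    agreeing-below⇒≮ {f = f} {g} {x} (f-into , f-mono , _) (_ , g-mono , g-initial)
                     x<a x<b agree fx<gx
      with g-initial (f x) x (f-into x x<a) x<b fx<gx
    ... | y , y<b , gy≡fx with ≤⊎> (proj₁ x<b) (proj₁ y<b)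
    ... | inj₂ y<x = <-irrefl (subst (_< f x) (trans (agree y y<x) gy≡fx)
                                     (f-mono y x (<-trans y<x x<a) x<a y<x))
    ... | inj₁ x≤y with ≤⇒≡⊎< x≤y
    ... | inj₁ refl = proj₂ fx<gx (sym gy≡fx)
    ... | inj₂ x<y = <⇒≱ fx<gx (subst (g x ≤_) gy≡fx (proj₁ (g-mono x y x<b y<b x<y)))

  HeightLe-agree : ∀ {a b s} (h : HeightLe a s) (h' : HeightLe b s) →
                   ∀ x → x < a → x < b → proj₁ h x ≡ proj₁ h' x
  HeightLe-agree {a} {b} (f , f-emb) (g , g-emb) =
    <-induction (λ x → x < a → x < b → f x ≡ g x) λ x ih x<a x<b → dne λ fx≢gx →
      let agree y y<x = ih y y<x (<-trans y<x x<a) (<-trans y<x x<b)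
      in [ agreeing-below⇒≮ f-emb g-emb x<a x<b agree
         , agreeing-below⇒≮ g-emb f-emb x<b x<a (λ y y<x → sym (agree y y<x)) ]′
         (≢⇒<⊎> (proj₁ (proj₁ f-emb x x<a)) (proj₁ (proj₁ g-emb x x<b)) fx≢gx)

  limit-HeightLe : ∀ {w s} → IsLimit w → (∀ y → y < w → HeightLe y s) → HeightLe w s
  limit-HeightLe {w} {s} lim below = F , into , mono , initial
    where
    emb : ∀ {y} → y < w → Carrier → Carrier
    emb y<w = proj₁ (below _ y<w)

    -- The fallback value x is never used: below a limit every x has some y above it.
    F : Carrier → Carrier
    F x with em {∃[ y ] ((x < y) × (y < w))}
    ... | yes (_ , _ , y<w) = emb y<w x
    ... | no _ = x

    F-agrees : ∀ {x y} → x < y → (y<w : y < w) → F x ≡ emb y<w x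
    F-agrees {x} {y} x<y y<w with em {∃[ y ] ((x < y) × (y < w))}
    ... | yes (y' , x<y' , y'<w) = HeightLe-agree (below y' y'<w) (below y y<w) x x<y' x<y
    ... | no none = ⊥-elim (none (y , x<y , y<w))

    into : ∀ x → x < w → F x < s
    into x x<w with limit⇒between lim x<w
    ... | y , x<y , y<w =
      subst (_< s) (sym (F-agrees x<y y<w)) (proj₁ (proj₂ (below y y<w)) x x<y)

    mono : ∀ x x' → x < w → x' < w → x < x' → F x < F x'
    mono x x' _ x'<w x<x' with limit⇒between lim x'<w
    ... | y , x'<y , y<w
      rewrite F-agrees (<-trans x<x' x'<y) y<w | F-agrees x'<y y<w =
      proj₁ (proj₂ (proj₂ (below y y<w))) x x' (<-trans x<x' x'<y) x'<y x<x'

    initial : ∀ z x → z < s → x < w → z < F x → ∃[ y ] ((y < w) × (F y ≡ z))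
    initial z x z<s x<w z<Fx with limit⇒between lim x<w
    ... | y , x<y , y<w
      with proj₂ (proj₂ (proj₂ (below y y<w))) z x z<s x<y (subst (z <_) (F-agrees x<y y<w) z<Fx)
    ... | y' , y'<y , emb-y'≡z = y' , <-trans y'<y y<w , trans (F-agrees y'<y y<w) emb-y'≡z


module ClassicalTGraphProperties (em : ExcludedMiddle 0ℓ) {T : OrderTree} (G : TGraph T) where
  open OrderTree T
  open TGraph G
  open OrderTreeProperties T
  open ClassicalOrderTreeProperties em T
  open TGraphProperties G

  private
    dne : DoubleNegationElimination 0ℓ
    dne = em⇒dne em

  ⌊⌋-connected-to-root : ∀ {X t} → (∀ y → t ≤ y → ¬ X y) → ∀ x → t ≤ x → Star (E-minus X) x t
  ⌊⌋-connected-to-root {X} {t} ⌊t⌋∌X = <-induction (λ x → t ≤ x → Star (E-minus X) x t) step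
    where
    step : ∀ x → (∀ y → y < x → t ≤ y → Star (E-minus X) y t) → t ≤ x → Star (E-minus X) x t
    step x ih t≤x with ≤⇒≡⊎< t≤x
    ... | inj₁ refl = ε
    ... | inj₂ t<x with E-cofinal x t t<x
    ... | u , t≤u , u<x , e = (⌊t⌋∌X x t≤x , ⌊t⌋∌X u t≤u , E-sym e) ◅ ih u u<x t≤u

  ⌊⌋-isComponent : ∀ {X t} → (∀ y → y < t → X y) → (∀ y → t ≤ y → ¬ X y) →
                   IsComponentMinus X ⌊ t ⌋
  ⌊⌋-isComponent {X} {t} below⊆X ⌊t⌋∌X = ⌊t⌋∌X , (t , ≤-refl t) , connected , closed
    where
    connected : ∀ x y → t ≤ x → t ≤ y → Star (E-minus X) x y
    connected x y t≤x t≤y =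
      ⌊⌋-connected-to-root ⌊t⌋∌X x t≤x ◅◅
      reverse (λ { (¬Xa , ¬Xb , e) → ¬Xb , ¬Xa , E-sym e }) (⌊⌋-connected-to-root ⌊t⌋∌X y t≤y)
    closed : ∀ x y → t ≤ x → ¬ X y → E x y → t ≤ y
    closed x y t≤x ¬Xy e = dne λ t≰y → ¬Xy (below⊆X y (edge-leaving-⌊⌋ t≤x e t≰y))

  ⌊successor⌋-isComponent : ∀ {t p} → IsSuccessorOf t p → IsComponentMinus (LevelUpTo p) ⌊ t ⌋
  ⌊successor⌋-isComponent t-succ-p =
    ⌊⌋-isComponent (λ y y<t → ≤⇒HeightLe (<-successor⇒≤ t-succ-p y<t))
                   (λ y t≤y → <⇒¬HeightLe (<-≤-trans (proj₁ t-succ-p) t≤y))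

  N⌊successor⌋-finite : ∀ {t p} → IsSuccessorOf t p → Finite (N ⌊ p ⌋) → Finite (N ⌊ t ⌋)
  N⌊successor⌋-finite {t} {p} t-succ-p (xs , N⌊p⌋⊆xs) = p ∷ xs , N⌊t⌋⊆p∷xs
    where
    N⌊t⌋⊆p∷xs : ∀ v → N ⌊ t ⌋ v → v ∈ p ∷ xs
    N⌊t⌋⊆p∷xs v (t≰v , u , t≤u , e) with ≤⇒≡⊎< (<-successor⇒≤ t-succ-p (edge-leaving-⌊⌋ t≤u e t≰v))
    ... | inj₁ refl = here refl
    ... | inj₂ v<p =
      there (N⌊p⌋⊆xs v (<⇒≱ v<p , u , ≤-trans (proj₁ (proj₁ t-succ-p)) t≤u , e))

  FiniteAdhesion : Set₁
  FiniteAdhesion = ∀ s → IsLimit s → ∀ C → IsComponentMinus (LevelUpTo s) C → Finite (N C)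

  FiniteAdhesionAtAllHeights : Set₁
  FiniteAdhesionAtAllHeights = ∀ s → ∀ C → IsComponentMinus (LevelUpTo s) C → Finite (N C)

  FiniteSuccessorUpClosures : Set
  FiniteSuccessorUpClosures = ∀ t → IsSuccessor t → Finite (N ⌊ t ⌋)

  allHeights⇒successors : FiniteAdhesionAtAllHeights → FiniteSuccessorUpClosures
  allHeights⇒successors adhesion t (p , t-succ-p) = adhesion p ⌊ t ⌋ (⌊successor⌋-isComponent t-succ-p)

  limits⇒successors : FiniteAdhesion → FiniteSuccessorUpClosures
  limits⇒successors adhesion = <-induction (λ t → IsSuccessor t → Finite (N ⌊ t ⌋)) step
    where
    step : ∀ t → (∀ y → y < t → IsSuccessor y → Finite (N ⌊ y ⌋)) → IsSuccessor t → Finite (N ⌊ t ⌋)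
    step t ih (p , t-succ-p) with em {IsSuccessor p}
    ... | no p-limit = adhesion p p-limit ⌊ t ⌋ (⌊successor⌋-isComponent t-succ-p)
    ... | yes p-succ = N⌊successor⌋-finite t-succ-p (ih p (proj₁ t-succ-p) p-succ)

  successors⇒allHeights : FiniteSuccessorUpClosures → FiniteAdhesionAtAllHeights
  successors⇒allHeights finite s C C-component@(C∌X , (x , Cx) , _) =
    Finite-⊆ (N-⊆ C⊆⌊w⌋ ⌊w⌋⊆C) N⌊w⌋-finite
    where
    X : Subset Carrier
    X = LevelUpTo s

    Outside-below-x : Subset Carrier
    Outside-below-x y = y ≤ x × ¬ X y

    least-outside : Σ Carrier λ w → Outside-below-x w × (∀ y → Outside-below-x y → w ≤ y)
    least-outside = least Outside-below-x x (λ _ → proj₁) (x , ≤-refl x , C∌X x Cx)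

    w : Carrier
    w = proj₁ least-outside

    w≤x : w ≤ x
    w≤x = proj₁ (proj₁ (proj₂ least-outside))

    ¬Xw : ¬ X w
    ¬Xw = proj₂ (proj₁ (proj₂ least-outside))

    below⊆X : ∀ y → y < w → X y
    below⊆X y y<w = dne λ ¬Xy →
      <⇒≱ y<w (proj₂ (proj₂ least-outside) y (≤-trans (proj₁ y<w) w≤x , ¬Xy))

    ⌊w⌋-component : IsComponentMinus X ⌊ w ⌋
    ⌊w⌋-component = ⌊⌋-isComponent below⊆X (λ y w≤y Xy → ¬Xw (≤-HeightLe-trans w≤y Xy))

    C⊆⌊w⌋ : ∀ v → C v → w ≤ v
    C⊆⌊w⌋ = component-⊆ C-component ⌊w⌋-component Cx w≤x

    ⌊w⌋⊆C : ∀ v → w ≤ v → C v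
    ⌊w⌋⊆C = component-⊆ ⌊w⌋-component C-component w≤x Cx

    N⌊w⌋-finite : Finite (N ⌊ w ⌋)
    N⌊w⌋-finite with em {IsSuccessor w}
    ... | yes w-succ = finite w w-succ
    ... | no w-limit = ⊥-elim (¬Xw (limit-HeightLe w-limit below⊆X))

lemma4p2 : ExcludedMiddle 0ℓ → (T : OrderTree) → (G : TGraph T) →
    let open OrderTree T in let open TGraph G in
    ((∀ s → IsLimit s → ∀ C → IsComponentMinus (LevelUpTo s) C → Finite (N C)) ⇔
    (∀ s → ∀ C → IsComponentMinus (LevelUpTo s) C → Finite (N C)))
    × ((∀ s → ∀ C → IsComponentMinus (LevelUpTo s) C → Finite (N C)) ⇔
    (∀ t → IsSuccessor t → Finite (N ⌊ t ⌋)))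
lemma4p2 em T G =
  mk⇔ (λ adhesion → successors⇒allHeights (limits⇒successors adhesion)) (λ adhesion s _ → adhesion s) ,
  mk⇔ allHeights⇒successors successors⇒allHeights
  where open ClassicalTGraphProperties em G
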